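{- Let $\mathcal{K}$ be a class of multi-sorted structures (in some fixed signature) having a designated sort $S$, and fix $n\in\mathbb{N}$. Let $\mathcal{A}$ be the class of all multi-sorted structures $A$ obtained from some member of $\mathcal{K}$ by adjoining a new sort $L$ carrying a lattice structure (operations $\cdot$ and $+$) and a relation $\rho\subseteq S\times S\times L$ (the only relation or operation connecting $L$ with the other sorts) such that, writing $\varepsilon(a):=\{(x,y)\mid x,y\in S,\ \rho(x,y,a)\}$ for $a\in L$: (1) $\varepsilon(a)$ is an equivalence relation on $S$ for each $a\in L$; (2) $a\mapsto\varepsilon(a)$ is injective; (3) $\varepsilon(a\cdot b)=\varepsilon(a)\cap\varepsilon(b)$ for all $a,b\in L$; (4) $\varepsilon(a+b)=\varepsilon(a)\bowtie_n\varepsilon(b)$ for all $a,b\in L$. Let $\mathcal{A}|L$ be the class of all lattices $A|L$ (the sort $L$ of $A$ with its lattice structure), $A\in\mathcal{A}$. If $\mathcal{K}$ is closed under direct products, then so are $\mathcal{A}$ and $\mathcal{A}|L$.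
   Context: For equivalence relations $\alpha,\beta$ on $S$, $\alpha\bowtie_n\beta=\alpha\circ\beta\circ\alpha\circ\cdots$ denotes the $n$-termed relational product alternating $\alpha$ and $\beta$. For $A\in\mathcal{A}$, $A^-$ denotes the structure obtained by removing the sort $L$ and the relation $\rho$; so $\mathcal{K}$ plays the role of $\mathcal{A}^-=\{A^-\mid A\in\mathcal{A}\}$. Direct products of multi-sorted structures are formed sort-wise; in particular in $\prod_{i\in I}A_i$ one has $\rho((x_i),(y_i),(a_i))$ iff $\rho_i(x_i,y_i,a_i)$ for all $i\in I$. -}

module Defs where

open import Level using (Level; _⊔_) renaming (suc to lsuc)
open import Data.Nat using (ℕ; zero; suc)
open import Data.List using (List; []; _∷_)
open import Data.List.Relation.Unary.All as All using (All; []; _∷_)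
open import Data.Product using (Σ; ∃; _×_; _,_)
open import Data.Unit.Polymorphic using (⊤)
open import Relation.Unary using (Pred)
open import Relation.Binary.Core using (Rel; _⇔_)
open import Relation.Binary.Bundles using (Setoid)
open import Relation.Binary.Structures using (IsEquivalence)
open import Relation.Binary.Construct.Intersection using (_∩_)
open import Algebra.Lattice.Bundles using (Lattice)
open import Algebra.Lattice.Morphism.Structures using (module LatticeMorphisms)

record Signature : Set₁ where
  field
    Sort   : Set
    Op     : Set
    RelSym : Set
    opDom  : Op → List Sort
    opCod  : Op → Sort
    relDom : RelSym → List Sort
open Signature public

module _ {ℓ : Level} {Sort : Set} (C : Sort → Setoid ℓ ℓ) where
  Args : List Sort → Set ℓ
  Args = All (λ s → Setoid.Carrier (C s))

  ArgsEq : ∀ {xs} → Args xs → Args xs → Set ℓ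
  ArgsEq []       []       = ⊤
  ArgsEq (a ∷ as) (b ∷ bs) = Setoid._≈_ (C _) a b × ArgsEq as bs

record Structure (Σ' : Signature) (ℓ : Level) : Set (lsuc ℓ) where
  field
    carrier : Sort Σ' → Setoid ℓ ℓ
    op      : (o : Op Σ') → Args carrier (opDom Σ' o) → Setoid.Carrier (carrier (opCod Σ' o))
    rel     : (r : RelSym Σ') → Args carrier (relDom Σ' r) → Set ℓ
    op-cong : ∀ o {as bs} → ArgsEq carrier as bs →
              Setoid._≈_ (carrier (opCod Σ' o)) (op o as) (op o bs)
    rel-resp : ∀ r {as bs} → ArgsEq carrier as bs → rel r as → rel r bs
    -- standard convention: every sort of a structure is nonempty
    point   : ∀ s → Setoid.Carrier (carrier s)

  ∣_∣ : Sort Σ' → Set ℓ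
  ∣ s ∣ = Setoid.Carrier (carrier s)

  _≈[_]_ : ∀ {s} → ∣ s ∣ → (s' : Sort Σ') → ∣ s ∣ → Set ℓ
  x ≈[ _ ] y = Setoid._≈_ (carrier _) x y
open Structure public

ΠSetoid : ∀ {ℓ} (I : Set ℓ) → (I → Setoid ℓ ℓ) → Setoid ℓ ℓ
ΠSetoid I C = record
  { Carrier = (i : I) → Setoid.Carrier (C i)
  ; _≈_ = λ f g → ∀ i → Setoid._≈_ (C i) (f i) (g i)
  ; isEquivalence = record
    { refl  = λ i → Setoid.refl (C i)
    ; sym   = λ p i → Setoid.sym (C i) (p i)
    ; trans = λ p q i → Setoid.trans (C i) (p i) (q i) } }

module _ {Σ' : Signature} {ℓ : Level} (I : Set ℓ) (A : I → Structure Σ' ℓ) where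
  private
    PC : Sort Σ' → Setoid ℓ ℓ
    PC s = ΠSetoid I (λ i → carrier (A i) s)

  proj-args : ∀ {xs} → Args PC xs → (i : I) → Args (carrier (A i)) xs
  proj-args as i = All.map (λ f → f i) as

  proj-argsEq : ∀ {xs} {as bs : Args PC xs} → ArgsEq PC as bs →
                (i : I) → ArgsEq (carrier (A i)) (proj-args as i) (proj-args bs i)
  proj-argsEq {[]}     {[]}     {[]}     _        i = _
  proj-argsEq {x ∷ xs} {a ∷ as} {b ∷ bs} (p , ps) i = p i , proj-argsEq ps i

  ΠStructure : Structure Σ' ℓ
  ΠStructure = record
    { carrier  = PC
    ; op       = λ o as i → op (A i) o (proj-args as i)
    ; rel      = λ r as → ∀ i → rel (A i) r (proj-args as i)
    ; op-cong  = λ o p i → op-cong (A i) o (proj-argsEq p i)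
    ; rel-resp = λ r p q i → rel-resp (A i) r (proj-argsEq p i) (q i)
    ; point    = λ s i → point (A i) s }

ΠLattice : ∀ {ℓ} (I : Set ℓ) → (I → Lattice ℓ ℓ) → Lattice ℓ ℓ
ΠLattice I L = record
  { Carrier = (i : I) → Lattice.Carrier (L i)
  ; _≈_ = λ f g → ∀ i → Lattice._≈_ (L i) (f i) (g i)
  ; _∨_ = λ f g i → Lattice._∨_ (L i) (f i) (g i)
  ; _∧_ = λ f g i → Lattice._∧_ (L i) (f i) (g i)
  ; isLattice = record
    { isEquivalence = record
      { refl  = λ i → Lattice.refl (L i)
      ; sym   = λ p i → Lattice.sym (L i) (p i)
      ; trans = λ p q i → Lattice.trans (L i) (p i) (q i) }
    ; ∨-comm  = λ f g i → Lattice.∨-comm (L i) (f i) (g i)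
    ; ∨-assoc = λ f g h i → Lattice.∨-assoc (L i) (f i) (g i) (h i)
    ; ∨-cong  = λ p q i → Lattice.∨-cong (L i) (p i) (q i)
    ; ∧-comm  = λ f g i → Lattice.∧-comm (L i) (f i) (g i)
    ; ∧-assoc = λ f g h i → Lattice.∧-assoc (L i) (f i) (g i) (h i)
    ; ∧-cong  = λ p q i → Lattice.∧-cong (L i) (p i) (q i)
    ; absorptive = (λ f g i → Data.Product.proj₁ (Lattice.absorptive (L i)) (f i) (g i))
                 , (λ f g i → Data.Product.proj₂ (Lattice.absorptive (L i)) (f i) (g i)) } }
  where import Data.Product

-- Relational product (same as Relation.Binary.Construct.Composition._;_,
-- whose name cannot be imported because ';' is a separator token)

_∘ᵣ_ : ∀ {ℓ} {A : Set ℓ} → Rel A ℓ → Rel A ℓ → Rel A ℓ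
(α ∘ᵣ β) x z = ∃ λ y → α x y × β y z

-- The n-termed alternating relational product  α ⋈[ n ] β = α ∘ β ∘ α ∘ ⋯
-- (n factors); the 0-termed product is the identity (diagonal) relation,
-- i.e. the setoid equality of S.

⋈ : ∀ {ℓ} (S : Setoid ℓ ℓ) → ℕ → Rel (Setoid.Carrier S) ℓ →
    Rel (Setoid.Carrier S) ℓ → Rel (Setoid.Carrier S) ℓ
⋈ S zero          α β = Setoid._≈_ S
⋈ S (suc zero)    α β = α
⋈ S (suc (suc n)) α β = α ∘ᵣ ⋈ S (suc n) β α

record Ext (Σ' : Signature) (S : Sort Σ') (ℓ : Level) : Set (lsuc ℓ) where
  field
    base : Structure Σ' ℓ
    L    : Lattice ℓ ℓ                     -- A|L  (· = _∧_ , + = _∨_)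
    ρ    : ∣ base ∣ S → ∣ base ∣ S → Lattice.Carrier L → Set ℓ
open Ext public

ε : ∀ {Σ' S ℓ} (A : Ext Σ' S ℓ) → Lattice.Carrier (L A) → Rel (∣ base A ∣ S) ℓ
ε A a x y = ρ A x y a

ΠExt : ∀ {Σ' S ℓ} (I : Set ℓ) → (I → Ext Σ' S ℓ) → Ext Σ' S ℓ
ΠExt I A = record
  { base = ΠStructure I (λ i → base (A i))
  ; L    = ΠLattice I (λ i → L (A i))
  ; ρ    = λ x y a → ∀ i → ρ (A i) (x i) (y i) (a i) }

record In𝒜 {Σ' : Signature} {ℓ ℓk : Level} (S : Sort Σ') (n : ℕ)
            (𝒦 : Pred (Structure Σ' ℓ) ℓk) (A : Ext Σ' S ℓ) : Set (ℓ ⊔ ℓk) where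
  open Lattice (L A) renaming (Carrier to ∣L∣)
  private
    SS = carrier (base A) S
    _≈S_ = Setoid._≈_ SS
  field
    base∈𝒦  : 𝒦 (base A)
    ρ-resp  : ∀ {x x' y y' a a'} → x ≈S x' → y ≈S y' → a ≈ a' →
              ρ A x y a → ρ A x' y' a'
    ε-equiv : ∀ a → IsEquivalence (ε A a)
    ε-inj   : ∀ a b → ε A a ⇔ ε A b → a ≈ b
    ε-meet  : ∀ a b → ε A (a ∧ b) ⇔ (ε A a ∩ ε A b)
    ε-join  : ∀ a b → ε A (a ∨ b) ⇔ ⋈ SS n (ε A a) (ε A b)

-- membership in the class 𝒜|L (a class of lattices, taken up to isomorphism)
In𝒜∣L : ∀ {Σ' : Signature} {ℓ ℓk : Level} (S : Sort Σ') (n : ℕ)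
        (𝒦 : Pred (Structure Σ' ℓ) ℓk) → Lattice ℓ ℓ → Set (lsuc ℓ ⊔ ℓk)
In𝒜∣L S n 𝒦 M = Σ (Ext _ S _) λ A → In𝒜 S n 𝒦 A ×
  ∃ λ (h : Lattice.Carrier (L A) → Lattice.Carrier M) →
    LatticeMorphisms.IsLatticeIsomorphism (Lattice.rawLattice (L A)) (Lattice.rawLattice M) h

ClosedΠ-Str : ∀ {Σ' ℓ ℓk} → Pred (Structure Σ' ℓ) ℓk → Set (lsuc ℓ ⊔ ℓk)
ClosedΠ-Str {ℓ = ℓ} 𝒦 = ∀ (I : Set ℓ) (A : I → Structure _ ℓ) → (∀ i → 𝒦 (A i)) → 𝒦 (ΠStructure I A)

ClosedΠ-Ext : ∀ {Σ' S ℓ ℓk} → Pred (Ext Σ' S ℓ) ℓk → Set (lsuc ℓ ⊔ ℓk)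
ClosedΠ-Ext {S = S} {ℓ = ℓ} 𝒜 = ∀ (I : Set ℓ) (A : I → Ext _ S ℓ) → (∀ i → 𝒜 (A i)) → 𝒜 (ΠExt I A)

ClosedΠ-Lat : ∀ {ℓ ℓk} → Pred (Lattice ℓ ℓ) ℓk → Set (lsuc ℓ ⊔ ℓk)
ClosedΠ-Lat {ℓ = ℓ} 𝒞 = ∀ (I : Set ℓ) (M : I → Lattice ℓ ℓ) → (∀ i → 𝒞 (M i)) → 𝒞 (ΠLattice I M)

{-# OPTIONS --safe #-}
module Submission where

-- Every condition defining 𝒜 holds in a product as soon as it holds in each
-- factor, because ρ, the lattice operations and the relational products ⋈ are
-- all computed coordinatewise (a witness of a relational product in the product
-- is assembled from witnesses in the factors).  The one exception is the
-- injectivity of ε: to see that ε(a) ⊆ ε(b) in the product forces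
-- εᵢ(aᵢ) ⊆ εᵢ(bᵢ), a pair (u, v) ∈ εᵢ(aᵢ) is placed at coordinate i and padded
-- with the diagonal pair (pⱼ, pⱼ) elsewhere, which needs decidable equality of
-- the index set; this is where excluded middle enters.

open import Defs
open import Level using (Level)
open import Data.Nat using (ℕ; zero; suc)
open import Data.Product using (_×_; _,_; proj₁; proj₂)
open import Data.Empty using (⊥-elim)
open import Relation.Unary using (Pred)
open import Relation.Binary.Core using (Rel; _⇒_; _⇔_)
open import Relation.Binary.Bundles using (Setoid)
open import Relation.Binary.Structures using (IsEquivalence)
open import Relation.Binary.Definitions using (Reflexive; DecidableEquality)
open import Relation.Binary.Construct.Intersection using (_∩_)
open import Relation.Binary.PropositionalEquality using (_≡_; refl; subst₂)
open import Relation.Nullary using (yes; no)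
open import Axiom.ExcludedMiddle using (ExcludedMiddle)
open import Algebra.Lattice.Bundles using (Lattice)
open import Algebra.Lattice.Morphism.Structures using (module LatticeMorphisms)

module _ {ℓ : Level} {A : Set ℓ} {P Q R : Rel A ℓ} where

  ⇔-trans : P ⇔ Q → Q ⇔ R → P ⇔ R
  ⇔-trans (P⇒Q , Q⇒P) (Q⇒R , R⇒Q) = (λ p → Q⇒R (P⇒Q p)) , (λ r → Q⇒P (R⇒Q r))

  ∘ᵣ-congʳ : Q ⇔ R → (P ∘ᵣ Q) ⇔ (P ∘ᵣ R)
  ∘ᵣ-congʳ (Q⇒R , R⇒Q) = (λ (y , p , q) → y , p , Q⇒R q) , (λ (y , p , r) → y , p , R⇒Q r)

module _ {ℓ : Level} {I : Set ℓ} {C : I → Set ℓ} where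

  Π-Rel : (∀ i → Rel (C i) ℓ) → Rel ((i : I) → C i) ℓ
  Π-Rel α x y = ∀ i → α i (x i) (y i)

  Π-isEquivalence : ∀ {α} → (∀ i → IsEquivalence (α i)) → IsEquivalence (Π-Rel α)
  Π-isEquivalence α-equiv = record
    { refl  = λ i → IsEquivalence.refl (α-equiv i)
    ; sym   = λ p i → IsEquivalence.sym (α-equiv i) (p i)
    ; trans = λ p q i → IsEquivalence.trans (α-equiv i) (p i) (q i) }

  module _ {α β : ∀ i → Rel (C i) ℓ} where

    Π-⇔ : (∀ i → α i ⇔ β i) → Π-Rel α ⇔ Π-Rel β
    Π-⇔ α⇔β = (λ p i → proj₁ (α⇔β i) (p i)) , (λ q i → proj₂ (α⇔β i) (q i))

    Π-∩ : Π-Rel (λ i → α i ∩ β i) ⇔ (Π-Rel α ∩ Π-Rel β)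
    Π-∩ = (λ p → (λ i → proj₁ (p i)) , (λ i → proj₂ (p i))) , (λ (p , q) i → p i , q i)

    Π-∘ᵣ : Π-Rel (λ i → α i ∘ᵣ β i) ⇔ (Π-Rel α ∘ᵣ Π-Rel β)
    Π-∘ᵣ = (λ p → (λ i → proj₁ (p i)) , (λ i → proj₁ (proj₂ (p i))) , (λ i → proj₂ (proj₂ (p i))))
         , (λ (y , p , q) i → y i , p i , q i)

  module _ (_≟_ : DecidableEquality I) (pt : ∀ i → C i) where

    inject : (i : I) → C i → (j : I) → C j
    inject i u j with i ≟ j
    ... | yes refl = u
    ... | no _     = pt j

    inject-self : ∀ i u → inject i u i ≡ u
    inject-self i u with i ≟ i
    ... | yes refl = refl
    ... | no i≢i   = ⊥-elim (i≢i refl)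

    Π-Rel-inject : ∀ {α} → (∀ j → Reflexive (α j)) →
                   ∀ i {u v} → α i u v → Π-Rel α (inject i u) (inject i v)
    Π-Rel-inject α-refl i uαv j with i ≟ j
    ... | yes refl = uαv
    ... | no _     = α-refl j

    Π-⇒-reflect : ∀ {α β} → (∀ j → Reflexive (α j)) →
                  Π-Rel α ⇒ Π-Rel β → ∀ i → α i ⇒ β i
    Π-⇒-reflect {α} {β} α-refl α⇒β i {u} {v} uαv =
      subst₂ (β i) (inject-self i u) (inject-self i v)
             (α⇒β {inject i u} {inject i v} (Π-Rel-inject {α} α-refl i uαv) i)

module _ {ℓ : Level} {I : Set ℓ} {C : I → Setoid ℓ ℓ} where

  Π-⋈ : ∀ n {α β} →
        Π-Rel (λ i → ⋈ (C i) n (α i) (β i)) ⇔ ⋈ (ΠSetoid I C) n (Π-Rel α) (Π-Rel β)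
  Π-⋈ zero          = (λ p → p) , (λ p → p)
  Π-⋈ (suc zero)    = (λ p → p) , (λ p → p)
  Π-⋈ (suc (suc n)) {α} {β} =
    ⇔-trans (Π-∘ᵣ {α = α} {λ i → ⋈ (C i) (suc n) (β i) (α i)}) (∘ᵣ-congʳ (Π-⋈ (suc n) {β} {α}))

module _ {ℓ : Level} {I : Set ℓ} {L M : I → Lattice ℓ ℓ} where
  open LatticeMorphisms using (IsLatticeIsomorphism)
  open Lattice using (rawLattice)

  Π-isLatticeIsomorphism :
    ∀ {h : ∀ i → Lattice.Carrier (L i) → Lattice.Carrier (M i)} →
    (∀ i → IsLatticeIsomorphism (rawLattice (L i)) (rawLattice (M i)) (h i)) →
    IsLatticeIsomorphism (rawLattice (ΠLattice I L)) (rawLattice (ΠLattice I M)) (λ x i → h i (x i))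
  Π-isLatticeIsomorphism h-iso = record
    { isLatticeMonomorphism = record
      { isLatticeHomomorphism = record
        { isRelHomomorphism = record { cong = λ p i → Iso.⟦⟧-cong i (p i) }
        ; ∧-homo = λ x y i → Iso.∧-homo i (x i) (y i)
        ; ∨-homo = λ x y i → Iso.∨-homo i (x i) (y i) }
      ; injective = λ p i → Iso.injective i (p i) }
    ; surjective = λ y → (λ i → proj₁ (Iso.surjective i (y i)))
                       , (λ p i → proj₂ (Iso.surjective i (y i)) (p i)) }
    where
    module Iso i = IsLatticeIsomorphism (h-iso i)

module _ {ℓ ℓk : Level} {Σ' : Signature} {S : Sort Σ'} {n : ℕ}
         {𝒦 : Pred (Structure Σ' ℓ) ℓk} (em : ExcludedMiddle ℓ) (𝒦-closed : ClosedΠ-Str 𝒦) where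

  Π-In𝒜 : ClosedΠ-Ext (In𝒜 S n 𝒦)
  Π-In𝒜 I A A∈𝒜 = record
    { base∈𝒦  = 𝒦-closed I (λ i → base (A i)) (λ i → 𝒜.base∈𝒦 i)
    ; ρ-resp  = λ x≈ y≈ a≈ r i → 𝒜.ρ-resp i (x≈ i) (y≈ i) (a≈ i) (r i)
    ; ε-equiv = λ a → Π-isEquivalence (λ i → 𝒜.ε-equiv i (a i))
    ; ε-inj   = λ a b (a⇒b , b⇒a) i → 𝒜.ε-inj i (a i) (b i) (reflect a a⇒b i , reflect b b⇒a i)
    ; ε-meet  = λ a b → ⇔-trans (Π-⇔ (λ i → 𝒜.ε-meet i (a i) (b i))) (Π-∩ {α = εᵢ a} {εᵢ b})
    ; ε-join  = λ a b → ⇔-trans (Π-⇔ (λ i → 𝒜.ε-join i (a i) (b i))) (Π-⋈ n {εᵢ a} {εᵢ b}) }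
    where
    module 𝒜 i = In𝒜 (A∈𝒜 i)

    εᵢ : (a : ∀ i → Lattice.Carrier (L (A i))) (i : I) → Rel (∣ base (A i) ∣ S) ℓ
    εᵢ a i = ε (A i) (a i)

    reflect : ∀ a {β} → Π-Rel (εᵢ a) ⇒ Π-Rel β → ∀ i → εᵢ a i ⇒ β i
    reflect a = Π-⇒-reflect (λ i j → em) (λ i → point (base (A i)) S) {εᵢ a}
                            (λ i → IsEquivalence.refl (𝒜.ε-equiv i (a i)))

  Π-In𝒜∣L : ClosedΠ-Lat (In𝒜∣L S n 𝒦)
  Π-In𝒜∣L I M M∈𝒜∣L =
    ΠExt I A , Π-In𝒜 I A A∈𝒜 , (λ x i → h i (x i)) ,
    Π-isLatticeIsomorphism {L = λ i → L (A i)} {M} (λ i → proj₂ (proj₂ (proj₂ (M∈𝒜∣L i))))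
    where
    A : I → Ext Σ' S ℓ
    A i = proj₁ (M∈𝒜∣L i)

    A∈𝒜 : ∀ i → In𝒜 S n 𝒦 (A i)
    A∈𝒜 i = proj₁ (proj₂ (M∈𝒜∣L i))

    h : ∀ i → Lattice.Carrier (L (A i)) → Lattice.Carrier (M i)
    h i = proj₁ (proj₂ (proj₂ (M∈𝒜∣L i)))

fact3 : ∀ {ℓ ℓk : Level} (Σ' : Signature) (S : Sort Σ') (n : ℕ)
        (𝒦 : Pred (Structure Σ' ℓ) ℓk) →
        ExcludedMiddle ℓ →
        ClosedΠ-Str 𝒦 →
        ClosedΠ-Ext (In𝒜 S n 𝒦) × ClosedΠ-Lat (In𝒜∣L S n 𝒦)
fact3 Σ' S n 𝒦 em 𝒦-closed = Π-In𝒜 em 𝒦-closed , Π-In𝒜∣L em 𝒦-closed
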